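{- Let $G\in\mathscr{F}_{n,3}$ and suppose $G$ contains edges $(a,c)$ and $(b,d)$ with $a<b<c<d$. Then $c=b+1$.
   Context: DAGs have vertex set $[n+1]$ and a multiset of edges $(i,j)$ with $i<j$ (parallel edges allowed). $\mathscr{F}_{n,3}$ is the set of such DAGs with out-degree sequence $(3,2,\dots,2,0)$ and in-degree sequence $(0,2,\dots,2,3)$. -}

module Defs where

open import Data.Nat using (ℕ; zero; suc; _≤_; _<_; _≟_)
open import Data.Product using (_×_; _,_; proj₁; proj₂)
open import Data.List using (List; []; _∷_)
open import Data.List.Relation.Unary.All using (All)
open import Relation.Nullary using (yes; no)
open import Relation.Binary.PropositionalEquality using (_≡_)

-- A DAG on vertex set [n+1] = {1,…,n+1}: a multiset (here: a list, order
-- irrelevant) of edges (i , j) with 1 ≤ i < j ≤ n+1.  Parallel edges allowed.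
Edge : Set
Edge = ℕ × ℕ

ValidEdge : ℕ → Edge → Set
ValidEdge n (i , j) = (1 ≤ i) × (i < j) × (j ≤ suc n)

outdeg : List Edge → ℕ → ℕ
outdeg [] v = 0
outdeg ((i , j) ∷ es) v with i ≟ v
... | yes _ = suc (outdeg es v)
... | no _  = outdeg es v

indeg : List Edge → ℕ → ℕ
indeg [] v = 0
indeg ((i , j) ∷ es) v with j ≟ v
... | yes _ = suc (indeg es v)
... | no _  = indeg es v

record InF3 (n : ℕ) (E : List Edge) : Set where
  field
    valid    : All (ValidEdge n) E
    out-first : outdeg E 1 ≡ 3
    out-mid   : ∀ v → 2 ≤ v → v ≤ n → outdeg E v ≡ 2
    out-last  : outdeg E (suc n) ≡ 0
    in-first  : indeg E 1 ≡ 0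
    in-mid    : ∀ v → 2 ≤ v → v ≤ n → indeg E v ≡ 2
    in-last   : indeg E (suc n) ≡ 3

-- Count the edges crossing the cut between k and k + 1.  Walking the cut one
-- vertex to the right loses the in-edges and gains the out-edges of the vertex
-- passed, so the degree sequences force exactly 3 crossing edges at every cut.
-- The edges crossing the cut before an inner vertex v are the 2 edges into v
-- together with the edges passing over v, so exactly one edge passes over v.
-- If c > b + 1, both (a , c) and (b , d) pass over b + 1.
module Submission where

open import Defs
open import Data.Nat using (ℕ; zero; suc; _+_; _≤_; _<_; _≟_; _<ᵇ_; _≡ᵇ_; z≤n; s≤s)
open import Data.Nat.Properties
  using (≡⇒≡ᵇ; ≡ᵇ⇒≡; <⇒<ᵇ; +-cancelˡ-≡; +-commutativeSemigroup; ≤-trans; ≤-pred;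
         m≤n+m; n≤1+n; 1+n≰n; <-trans; <-≤-trans; <⇒≢; n<1+n; m<n⇒m<1+n; m≤n⇒m<n∨m≡n)
open import Algebra.Properties.CommutativeSemigroup +-commutativeSemigroup using (interchange)
open import Data.Bool using (Bool; true; false; _∧_; T)
open import Data.Bool.Properties using (T-∧)
open import Data.Product using (_,_; proj₁; proj₂)
open import Data.Sum using (inj₁; inj₂)
open import Data.List using (List; []; _∷_)
open import Data.List.Relation.Unary.All as All using (All; []; _∷_)
open import Data.List.Relation.Unary.Any using (here; there)
open import Data.List.Membership.Propositional using (_∈_)
open import Data.Unit using (tt)
open import Data.Empty using (⊥-elim)
open import Function using (_∘_; _$_; Equivalence)
open import Relation.Nullary using (¬_; yes; no; contradiction)
open import Relation.Binary.PropositionalEquality using (_≡_; _≢_; refl; sym; cong; cong₂; subst; module ≡-Reasoning)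
open ≡-Reasoning

indicator : Bool → ℕ
indicator true  = 1
indicator false = 0

indicator-true : ∀ {b} → T b → indicator b ≡ 1
indicator-true {true} _ = refl

indicator-false : ∀ {b} → ¬ T b → indicator b ≡ 0
indicator-false {true}  ¬t = ⊥-elim (¬t tt)
indicator-false {false} _  = refl

count : ∀ {A : Set} → (A → Bool) → List A → ℕ
count p []       = 0
count p (x ∷ xs) = indicator (p x) + count p xs

count-split : ∀ {A : Set} {P : A → Set} (p q r : A → Bool) →
              (∀ {x} → P x → indicator (p x) ≡ indicator (q x) + indicator (r x)) →
              ∀ {xs} → All P xs → count p xs ≡ count q xs + count r xs
count-split p q r split []                  = refl
count-split p q r split {x ∷ xs} (px ∷ pxs) = begin
  indicator (p x) + count p xs
    ≡⟨ cong₂ _+_ (split px) (count-split p q r split pxs) ⟩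
  (indicator (q x) + indicator (r x)) + (count q xs + count r xs)
    ≡⟨ interchange (indicator (q x)) (indicator (r x)) (count q xs) (count r xs) ⟩
  count q (x ∷ xs) + count r (x ∷ xs)
    ∎

∈⇒1≤count : ∀ {A : Set} (p : A → Bool) {x} {xs} → x ∈ xs → T (p x) → 1 ≤ count p xs
∈⇒1≤count p (here refl) px rewrite indicator-true px = s≤s z≤n
∈⇒1≤count p {xs = y ∷ _} (there x∈xs) px =
  ≤-trans (∈⇒1≤count p x∈xs px) (m≤n+m _ (indicator (p y)))

distinct-∈⇒2≤count : ∀ {A : Set} (p : A → Bool) {x y} {xs} → x ∈ xs → y ∈ xs →
                     x ≢ y → T (p x) → T (p y) → 2 ≤ count p xs
distinct-∈⇒2≤count p (here refl) (here refl) x≢y px py = contradiction refl x≢y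
distinct-∈⇒2≤count p (here refl) (there y∈xs) x≢y px py
  rewrite indicator-true px = s≤s (∈⇒1≤count p y∈xs py)
distinct-∈⇒2≤count p (there x∈xs) (here refl) x≢y px py
  rewrite indicator-true py = s≤s (∈⇒1≤count p x∈xs px)
distinct-∈⇒2≤count p {xs = z ∷ _} (there x∈xs) (there y∈xs) x≢y px py =
  ≤-trans (distinct-∈⇒2≤count p x∈xs y∈xs x≢y px py) (m≤n+m _ (indicator (p z)))

leaves enters : ℕ → Edge → Bool
leaves v (i , j) = i ≡ᵇ v
enters v (i , j) = j ≡ᵇ v

outdeg≡count : ∀ E v → outdeg E v ≡ count (leaves v) E
outdeg≡count []             v = refl
outdeg≡count ((i , j) ∷ es) v with i ≟ v
... | yes i≡v = cong₂ _+_ (sym (indicator-true (≡⇒≡ᵇ i v i≡v))) (outdeg≡count es v)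
... | no  i≢v = cong₂ _+_ (sym (indicator-false (i≢v ∘ ≡ᵇ⇒≡ i v))) (outdeg≡count es v)

indeg≡count : ∀ E v → indeg E v ≡ count (enters v) E
indeg≡count []             v = refl
indeg≡count ((i , j) ∷ es) v with j ≟ v
... | yes j≡v = cong₂ _+_ (sym (indicator-true (≡⇒≡ᵇ j v j≡v))) (indeg≡count es v)
... | no  j≢v = cong₂ _+_ (sym (indicator-false (j≢v ∘ ≡ᵇ⇒≡ j v))) (indeg≡count es v)

-- i ≤ k is written i <ᵇ suc k, which (unlike _≤ᵇ_) reduces under suc on both sides.
crosses passesOver : ℕ → Edge → Bool
crosses    k (i , j) = (i <ᵇ suc k) ∧ (k <ᵇ j)
passesOver v (i , j) = (i <ᵇ v) ∧ (v <ᵇ j)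

passesOver-intro : ∀ {i v j} → i < v → v < j → T (passesOver v (i , j))
passesOver-intro i<v v<j = Equivalence.from T-∧ (<⇒<ᵇ i<v , <⇒<ᵇ v<j)

<ᵇ-split : ∀ k j → indicator (k <ᵇ j) ≡ indicator (j ≡ᵇ suc k) + indicator (suc k <ᵇ j)
<ᵇ-split k       zero          = refl
<ᵇ-split zero    (suc zero)    = refl
<ᵇ-split zero    (suc (suc j)) = refl
<ᵇ-split (suc k) (suc j)       = <ᵇ-split k j

crosses≡enters+passesOver : ∀ {i j} k → i < j →
  indicator (crosses k (i , j)) ≡
  indicator (enters (suc k) (i , j)) + indicator (passesOver (suc k) (i , j))
crosses≡enters+passesOver {zero}  {j}           k       _       = <ᵇ-split k j
crosses≡enters+passesOver {suc i} {suc (suc j)} zero    _       = refl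
crosses≡enters+passesOver {suc i} {suc j}       (suc k) (s≤s p) = crosses≡enters+passesOver k p

crosses≡leaves+passesOver : ∀ {i j} k → i < j →
  indicator (crosses (suc k) (i , j)) ≡
  indicator (leaves (suc k) (i , j)) + indicator (passesOver (suc k) (i , j))
crosses≡leaves+passesOver {zero}                      k       _       = refl
crosses≡leaves+passesOver {suc zero}    {suc (suc j)} zero    _       = refl
crosses≡leaves+passesOver {suc (suc i)}               zero    _       = refl
crosses≡leaves+passesOver {suc i}       {suc j}       (suc k) (s≤s p) = crosses≡leaves+passesOver k p

module _ {n : ℕ} {E : List Edge} (valid : All (ValidEdge n) E) where

  count-crosses≡indeg+passesOver : ∀ k → count (crosses k) E ≡ indeg E (suc k) + count (passesOver (suc k)) E
  count-crosses≡indeg+passesOver k = begin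
    count (crosses k) E
      ≡⟨ count-split (crosses k) (enters (suc k)) (passesOver (suc k))
                     (crosses≡enters+passesOver k ∘ proj₁ ∘ proj₂) valid ⟩
    count (enters (suc k)) E + count (passesOver (suc k)) E
      ≡⟨ cong (_+ count (passesOver (suc k)) E) (sym (indeg≡count E (suc k))) ⟩
    indeg E (suc k) + count (passesOver (suc k)) E
      ∎

  count-crosses≡outdeg+passesOver : ∀ k → count (crosses (suc k)) E ≡ outdeg E (suc k) + count (passesOver (suc k)) E
  count-crosses≡outdeg+passesOver k = begin
    count (crosses (suc k)) E
      ≡⟨ count-split (crosses (suc k)) (leaves (suc k)) (passesOver (suc k))
                     (crosses≡leaves+passesOver k ∘ proj₁ ∘ proj₂) valid ⟩
    count (leaves (suc k)) E + count (passesOver (suc k)) E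
      ≡⟨ cong (_+ count (passesOver (suc k)) E) (sym (outdeg≡count E (suc k))) ⟩
    outdeg E (suc k) + count (passesOver (suc k)) E
      ∎

  count-crosses0≡0 : count (crosses 0) E ≡ 0
  count-crosses0≡0 = go valid
    where
    go : ∀ {es} → All (ValidEdge n) es → count (crosses 0) es ≡ 0
    go []                             = refl
    go {(suc i , j) ∷ _} (_ ∷ valids) = go valids

module _ {n : ℕ} {E : List Edge} (G : InF3 n E) where
  open InF3 G

  count-passesOver≡1 : ∀ k → suc (suc k) ≤ n → count (passesOver (suc (suc k))) E ≡ 1
  count-crosses≡3 : ∀ k → k < n → count (crosses (suc k)) E ≡ 3

  count-passesOver≡1 k 2+k≤n = +-cancelˡ-≡ 2 _ 1 $ begin
    2 + count (passesOver (suc (suc k))) E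
      ≡⟨ cong (_+ count (passesOver (suc (suc k))) E) (sym (in-mid (suc (suc k)) (s≤s (s≤s z≤n)) 2+k≤n)) ⟩
    indeg E (suc (suc k)) + count (passesOver (suc (suc k))) E
      ≡⟨ sym (count-crosses≡indeg+passesOver valid (suc k)) ⟩
    count (crosses (suc k)) E
      ≡⟨ count-crosses≡3 k (≤-trans (n≤1+n (suc k)) 2+k≤n) ⟩
    3 ∎

  count-crosses≡3 zero    _     = begin
    count (crosses 1) E                      ≡⟨ count-crosses≡outdeg+passesOver valid 0 ⟩
    outdeg E 1 + count (passesOver 1) E      ≡⟨ cong₂ _+_ out-first nothing-passes-over-1 ⟩
    3 ∎
    where
    nothing-passes-over-1 : count (passesOver 1) E ≡ 0
    nothing-passes-over-1 = sym $ begin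
      0                                     ≡⟨ sym (count-crosses0≡0 valid) ⟩
      count (crosses 0) E                   ≡⟨ count-crosses≡indeg+passesOver valid 0 ⟩
      indeg E 1 + count (passesOver 1) E    ≡⟨ cong (_+ count (passesOver 1) E) in-first ⟩
      count (passesOver 1) E                ∎
  count-crosses≡3 (suc k) 1+k<n = begin
    count (crosses (suc (suc k))) E
      ≡⟨ count-crosses≡outdeg+passesOver valid (suc k) ⟩
    outdeg E (suc (suc k)) + count (passesOver (suc (suc k))) E
      ≡⟨ cong₂ _+_ (out-mid (suc (suc k)) (s≤s (s≤s z≤n)) 1+k<n) (count-passesOver≡1 k 1+k<n) ⟩
    3 ∎

proposition3p17 : (n : ℕ) (E : List Edge) → InF3 n E →
    (a b c d : ℕ) → (a , c) ∈ E → (b , d) ∈ E →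
    a < b → b < c → c < d → c ≡ suc b
proposition3p17 n E G a zero    c d _  _  ()  _   _
proposition3p17 n E G a (suc b) c d ac bd a<b b<c c<d with m≤n⇒m<n∨m≡n b<c
... | inj₂ b+1≡c = sym b+1≡c
... | inj₁ b+1<c = ⊥-elim (1+n≰n (subst (2 ≤_) over-b+1≡1 over-b+1≥2))
  where
  d≤n+1 : d ≤ suc n
  d≤n+1 = proj₂ (proj₂ (All.lookup (InF3.valid G) bd))
  over-b+1≡1 : count (passesOver (suc (suc b))) E ≡ 1
  over-b+1≡1 = count-passesOver≡1 G b (≤-pred (<-≤-trans (<-trans b+1<c c<d) d≤n+1))
  over-b+1≥2 : 2 ≤ count (passesOver (suc (suc b))) E
  over-b+1≥2 = distinct-∈⇒2≤count (passesOver (suc (suc b))) ac bd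
                 (<⇒≢ a<b ∘ cong proj₁)
                 (passesOver-intro (m<n⇒m<1+n a<b) b+1<c)
                 (passesOver-intro (n<1+n (suc b)) (<-trans b+1<c c<d))
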